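{- Let $r \geq 3$ and let $G$ be a graph on $r+1$ vertices with maximum degree $\Delta(G) \leq r-1$. If any two vertices of degree $r-1$ in $G$ are adjacent, then \[ |E(G)| \leq \binom{r+1}{2} - \left\lceil \frac{2(r+1)}{3} \right\rceil = \left\lfloor \frac{(r+1)(3r-4)}{6} \right\rfloor. \] -}

module Defs where

open import Data.Bool using (Bool; true; false; T; if_then_else_)
open import Data.Nat using (ℕ; zero; suc; _+_; _*_; _∸_; _<ᵇ_)
open import Data.Nat.DivMod using (_/_)
open import Data.Fin using (Fin; toℕ)
open import Data.List using (List; length; filterᵇ; allFin; concatMap; map)
open import Data.Product using (_×_; _,_)
open import Relation.Binary.PropositionalEquality using (_≡_)
open import Data.Empty using (⊥)

record Graph (n : ℕ) : Set where
  field
    adj   : Fin n → Fin n → Bool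
    sym   : ∀ i j → adj i j ≡ adj j i
    irrefl : ∀ i → adj i i ≡ false
open Graph public

Adj : ∀ {n} → Graph n → Fin n → Fin n → Set
Adj G i j = T (adj G i j)

degree : ∀ {n} → Graph n → Fin n → ℕ
degree {n} G v = length (filterᵇ (adj G v) (allFin n))

edgeCount : ∀ {n} → Graph n → ℕ
edgeCount {n} G =
  length (filterᵇ (λ p → isEdge p) (concatMap (λ i → map (λ j → (i , j)) (allFin n)) (allFin n)))
  where
  isEdge : Fin n × Fin n → Bool
  isEdge (i , j) = if toℕ i <ᵇ toℕ j then adj G i j else false

⌈_/3⌉ : ℕ → ℕ
⌈ a /3⌉ = (a + 2) / 3

-- Pass to the complement Ḡ of G. Since Δ(G) ≤ r − 1, every vertex of Ḡ has
-- degree at least 1, and the leaves of Ḡ are exactly the vertices of degree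
-- r − 1 in G; these are pairwise adjacent in G, so the leaves of Ḡ form an
-- independent set. In a graph on n vertices without isolated vertices whose k
-- leaves are independent, summing deg v + [v is a leaf] ≥ 2 gives
-- 2n ≤ 2|E| + k, and double counting the edges at the leaves gives k ≤ |E|;
-- hence 2n ≤ 3|E(Ḡ)|, and |E(G)| = C(n,2) − |E(Ḡ)| ≤ C(n,2) − ⌈2n/3⌉.
-- For the closed form (n = r + 1) write 3⌈2n/3⌉ = 2n + t with t ≤ 2: then
-- n(3r − 4) = 6(C(n,2) − ⌈2n/3⌉) + 2t, and 2t < 6.
module Submission where

open import Data.Bool using (Bool; true; false; T; not; _∧_; if_then_else_)
open import Data.Bool.Properties using (∧-zeroʳ)
open import Data.Empty using (⊥-elim)
open import Data.Fin using (Fin; toℕ; _≟_) renaming (zero to fzero; suc to fsuc)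
open import Data.Fin.Properties using (toℕ-injective)
open import Data.List using (List; []; _∷_; _++_; length; filterᵇ; tabulate; concatMap; map; allFin)
open import Data.List.Properties using (length-++; filter-++; map-tabulate)
open import Data.Nat using (ℕ; zero; suc; NonZero; _+_; _*_; _∸_; _≤_; _<_; _<ᵇ_; _≡ᵇ_; z≤n; s≤s)
open import Data.Nat.Combinatorics using (_C_; nCk+nC[k+1]≡[n+1]C[k+1]; nC1≡n)
open import Data.Nat.DivMod using (_/_; _%_; m≡m%n+[m/n]*n; m%n<n; m<n*o⇒m/o<n; +-distrib-/-∣ʳ; m<n⇒m/n≡0; m*n/n≡m)
open import Data.Nat.Divisibility using (n∣m*n)
open import Data.Nat.Properties hiding (_≟_)
open import Data.Nat.Tactic.RingSolver using (solve)
open import Data.Product using (_×_; _,_; ∃-syntax)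
open import Function using (_∘_; id)
open import Relation.Binary.PropositionalEquality
open import Relation.Nullary using (¬_; does; yes; no; contradiction)
open import Relation.Nullary.Decidable using (T?; dec-true; dec-false)
open import Relation.Nullary.Reflects using (ofʸ; ofⁿ)

open import Defs hiding (sym)
open import Algebra.Properties.Semiring.Sum +-*-semiring
  using (sum-syntax; sum-cong-≗; sum-replicate-zero; ∑-distrib-+; ∑-comm; *-distribʳ-sum)

⟦_⟧ : Bool → ℕ
⟦ true ⟧  = 1
⟦ false ⟧ = 0

⟦a⟧*[⟦p⟧+⟦q⟧]≤⟦a⟧ : ∀ a p q → (T p → T q → ¬ T a) → ⟦ a ⟧ * (⟦ p ⟧ + ⟦ q ⟧) ≤ ⟦ a ⟧
⟦a⟧*[⟦p⟧+⟦q⟧]≤⟦a⟧ false _     _     _      = z≤n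
⟦a⟧*[⟦p⟧+⟦q⟧]≤⟦a⟧ true  true  true  p∧q⇒¬a = contradiction _ (p∧q⇒¬a _ _)
⟦a⟧*[⟦p⟧+⟦q⟧]≤⟦a⟧ true  true  false _      = ≤-refl
⟦a⟧*[⟦p⟧+⟦q⟧]≤⟦a⟧ true  false true  _      = ≤-refl
⟦a⟧*[⟦p⟧+⟦q⟧]≤⟦a⟧ true  false false _      = z≤n

n*⟦n≡ᵇ1⟧≡⟦n≡ᵇ1⟧ : ∀ n → n * ⟦ n ≡ᵇ 1 ⟧ ≡ ⟦ n ≡ᵇ 1 ⟧
n*⟦n≡ᵇ1⟧≡⟦n≡ᵇ1⟧ 0             = refl
n*⟦n≡ᵇ1⟧≡⟦n≡ᵇ1⟧ 1             = refl
n*⟦n≡ᵇ1⟧≡⟦n≡ᵇ1⟧ (suc (suc n)) = *-zeroʳ (suc (suc n))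

1≤n⇒2≤n+⟦n≡ᵇ1⟧ : ∀ {n} → 1 ≤ n → 2 ≤ n + ⟦ n ≡ᵇ 1 ⟧
1≤n⇒2≤n+⟦n≡ᵇ1⟧ {1}           _ = ≤-refl
1≤n⇒2≤n+⟦n≡ᵇ1⟧ {suc (suc n)} _ = s≤s (s≤s z≤n)

∑-const : ∀ n c → ∑[ i < n ] c ≡ n * c
∑-const zero    c = refl
∑-const (suc n) c = cong (c +_) (∑-const n c)

∑-mono-≤ : ∀ {n} {f g : Fin n → ℕ} → (∀ i → f i ≤ g i) → ∑[ i < n ] f i ≤ ∑[ i < n ] g i
∑-mono-≤ {zero}  f≤g = z≤n
∑-mono-≤ {suc n} f≤g = +-mono-≤ (f≤g fzero) (∑-mono-≤ (f≤g ∘ fsuc))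

∑⟦i≟j⟧≡1 : ∀ {n} (i : Fin n) → ∑[ j < n ] ⟦ does (i ≟ j) ⟧ ≡ 1
∑⟦i≟j⟧≡1 {suc n} fzero    = cong suc (sum-replicate-zero n)
∑⟦i≟j⟧≡1         (fsuc i) = ∑⟦i≟j⟧≡1 i

module _ {B : Set} (p : B → Bool) where

  length-filterᵇ-tabulate : ∀ {n} (f : Fin n → B) →
    length (filterᵇ p (tabulate f)) ≡ ∑[ i < n ] ⟦ p (f i) ⟧
  length-filterᵇ-tabulate {zero}  f = refl
  length-filterᵇ-tabulate {suc n} f with p (f fzero)
  ... | true  = cong suc (length-filterᵇ-tabulate (f ∘ fsuc))
  ... | false = length-filterᵇ-tabulate (f ∘ fsuc)

  length-filterᵇ-concatMap : ∀ {A : Set} {n} (g : A → List B) (f : Fin n → A) →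
    length (filterᵇ p (concatMap g (tabulate f))) ≡ ∑[ i < n ] length (filterᵇ p (g (f i)))
  length-filterᵇ-concatMap {n = zero}  g f = refl
  length-filterᵇ-concatMap {n = suc n} g f = begin
    length (filterᵇ p (g (f fzero) ++ rest))                    ≡⟨ cong length (filter-++ (T? ∘ p) (g (f fzero)) rest) ⟩
    length (filterᵇ p (g (f fzero)) ++ filterᵇ p rest)          ≡⟨ length-++ (filterᵇ p (g (f fzero))) ⟩
    length (filterᵇ p (g (f fzero))) + length (filterᵇ p rest)  ≡⟨ cong (_ +_) (length-filterᵇ-concatMap g (f ∘ fsuc)) ⟩
    ∑[ i < suc n ] length (filterᵇ p (g (f i)))                 ∎
    where
    open ≡-Reasoning
    rest = concatMap g (tabulate (f ∘ fsuc))

module _ {n : ℕ} (G : Graph n) where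

  orderedAdj : Fin n → Fin n → Bool
  orderedAdj i j = if toℕ i <ᵇ toℕ j then adj G i j else false

  degree≡∑ : ∀ v → degree G v ≡ ∑[ j < n ] ⟦ adj G v j ⟧
  degree≡∑ v = length-filterᵇ-tabulate (adj G v) id

  edgeCount≡∑ : edgeCount G ≡ ∑[ i < n ] ∑[ j < n ] ⟦ orderedAdj i j ⟧
  edgeCount≡∑ = begin
    edgeCount G
      ≡⟨ length-filterᵇ-concatMap isEdge (λ i → map (i ,_) (allFin n)) id ⟩
    ∑[ i < n ] length (filterᵇ isEdge (map (i ,_) (tabulate id)))
      ≡⟨ sum-cong-≗ (λ i → cong (length ∘ filterᵇ isEdge) (map-tabulate id (i ,_))) ⟩
    ∑[ i < n ] length (filterᵇ isEdge (tabulate (i ,_)))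
      ≡⟨ sum-cong-≗ (λ i → length-filterᵇ-tabulate isEdge (i ,_)) ⟩
    ∑[ i < n ] ∑[ j < n ] ⟦ orderedAdj i j ⟧
      ∎
    where
    open ≡-Reasoning
    isEdge : Fin n × Fin n → Bool
    isEdge (i , j) = orderedAdj i j

  ⟦adj⟧≡⟦orderedAdj⟧+⟦orderedAdj⟧ : ∀ i j → ⟦ adj G i j ⟧ ≡ ⟦ orderedAdj i j ⟧ + ⟦ orderedAdj j i ⟧
  ⟦adj⟧≡⟦orderedAdj⟧+⟦orderedAdj⟧ i j
    with toℕ i <ᵇ toℕ j | <ᵇ-reflects-< (toℕ i) (toℕ j) | toℕ j <ᵇ toℕ i | <ᵇ-reflects-< (toℕ j) (toℕ i)
  ... | true  | ofʸ i<j | true  | ofʸ j<i = contradiction j<i (<-asym i<j)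
  ... | true  | _       | false | _       = sym (+-identityʳ _)
  ... | false | _       | true  | _       = cong ⟦_⟧ (Graph.sym G i j)
  ... | false | ofⁿ i≮j | false | ofⁿ j≮i = cong ⟦_⟧ (trans (cong (adj G i) (sym i≡j)) (irrefl G i))
    where i≡j = toℕ-injective (≤-antisym (≮⇒≥ j≮i) (≮⇒≥ i≮j))

  ∑-degree≡∑∑⟦adj⟧ : ∑[ v < n ] degree G v ≡ ∑[ i < n ] ∑[ j < n ] ⟦ adj G i j ⟧
  ∑-degree≡∑∑⟦adj⟧ = sum-cong-≗ degree≡∑

  handshake : ∑[ v < n ] degree G v ≡ 2 * edgeCount G
  handshake = begin
    ∑[ v < n ] degree G v
      ≡⟨ ∑-degree≡∑∑⟦adj⟧ ⟩
    ∑[ i < n ] ∑[ j < n ] ⟦ adj G i j ⟧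
      ≡⟨ sum-cong-≗ (λ i → sum-cong-≗ (⟦adj⟧≡⟦orderedAdj⟧+⟦orderedAdj⟧ i)) ⟩
    ∑[ i < n ] ∑[ j < n ] (⟦ orderedAdj i j ⟧ + ⟦ orderedAdj j i ⟧)
      ≡⟨ sum-cong-≗ (λ i → ∑-distrib-+ (⟦_⟧ ∘ orderedAdj i) (λ j → ⟦ orderedAdj j i ⟧)) ⟩
    ∑[ i < n ] (∑[ j < n ] ⟦ orderedAdj i j ⟧ + ∑[ j < n ] ⟦ orderedAdj j i ⟧)
      ≡⟨ ∑-distrib-+ (λ i → ∑[ j < n ] ⟦ orderedAdj i j ⟧) (λ i → ∑[ j < n ] ⟦ orderedAdj j i ⟧) ⟩
    E + ∑[ i < n ] ∑[ j < n ] ⟦ orderedAdj j i ⟧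
      ≡⟨ cong (E +_) (∑-comm (λ i j → ⟦ orderedAdj j i ⟧)) ⟩
    E + E
      ≡⟨ cong (E +_) (sym (+-identityʳ E)) ⟩
    2 * E
      ≡⟨ cong (2 *_) edgeCount≡∑ ⟨
    2 * edgeCount G
      ∎
    where
    open ≡-Reasoning
    E = ∑[ i < n ] ∑[ j < n ] ⟦ orderedAdj i j ⟧

module _ {n : ℕ} (G : Graph n) (P : Fin n → Bool) where

  ∑-degree*⟦P⟧≡∑∑ : ∑[ u < n ] (degree G u * ⟦ P u ⟧) ≡ ∑[ u < n ] ∑[ v < n ] (⟦ adj G u v ⟧ * ⟦ P u ⟧)
  ∑-degree*⟦P⟧≡∑∑ = sum-cong-≗ λ u →
    trans (cong (_* ⟦ P u ⟧) (degree≡∑ G u)) (*-distribʳ-sum ⟦ P u ⟧ (⟦_⟧ ∘ adj G u))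

  ∑-degree*⟦P⟧≡∑∑ᵀ : ∑[ v < n ] (degree G v * ⟦ P v ⟧) ≡ ∑[ u < n ] ∑[ v < n ] (⟦ adj G u v ⟧ * ⟦ P v ⟧)
  ∑-degree*⟦P⟧≡∑∑ᵀ = begin
    ∑[ v < n ] (degree G v * ⟦ P v ⟧)                 ≡⟨ ∑-degree*⟦P⟧≡∑∑ ⟩
    ∑[ v < n ] ∑[ u < n ] (⟦ adj G v u ⟧ * ⟦ P v ⟧)   ≡⟨ ∑-comm (λ v u → ⟦ adj G v u ⟧ * ⟦ P v ⟧) ⟩
    ∑[ u < n ] ∑[ v < n ] (⟦ adj G v u ⟧ * ⟦ P v ⟧)
      ≡⟨ sum-cong-≗ (λ u → sum-cong-≗ λ v → cong (λ b → ⟦ b ⟧ * ⟦ P v ⟧) (Graph.sym G v u)) ⟩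
    ∑[ u < n ] ∑[ v < n ] (⟦ adj G u v ⟧ * ⟦ P v ⟧)   ∎
    where open ≡-Reasoning

  ∑-degree-independent≤edgeCount : (∀ u v → T (P u) → T (P v) → ¬ Adj G u v) →
    ∑[ v < n ] (degree G v * ⟦ P v ⟧) ≤ edgeCount G
  ∑-degree-independent≤edgeCount independent = *-cancelˡ-≤ 2 (begin
    2 * W
      ≡⟨ cong (W +_) (+-identityʳ W) ⟩
    W + W
      ≡⟨ cong₂ _+_ ∑-degree*⟦P⟧≡∑∑ ∑-degree*⟦P⟧≡∑∑ᵀ ⟩
    ∑[ u < n ] ∑[ v < n ] (⟦ adj G u v ⟧ * ⟦ P u ⟧) + ∑[ u < n ] ∑[ v < n ] (⟦ adj G u v ⟧ * ⟦ P v ⟧)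
      ≡⟨ ∑-distrib-+ (λ u → ∑[ v < n ] (⟦ adj G u v ⟧ * ⟦ P u ⟧)) (λ u → ∑[ v < n ] (⟦ adj G u v ⟧ * ⟦ P v ⟧)) ⟨
    ∑[ u < n ] (∑[ v < n ] (⟦ adj G u v ⟧ * ⟦ P u ⟧) + ∑[ v < n ] (⟦ adj G u v ⟧ * ⟦ P v ⟧))
      ≡⟨ sum-cong-≗ (λ u → ∑-distrib-+ (λ v → ⟦ adj G u v ⟧ * ⟦ P u ⟧) (λ v → ⟦ adj G u v ⟧ * ⟦ P v ⟧)) ⟨
    ∑[ u < n ] ∑[ v < n ] (⟦ adj G u v ⟧ * ⟦ P u ⟧ + ⟦ adj G u v ⟧ * ⟦ P v ⟧)
      ≡⟨ sum-cong-≗ (λ u → sum-cong-≗ λ v → *-distribˡ-+ ⟦ adj G u v ⟧ ⟦ P u ⟧ ⟦ P v ⟧) ⟨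
    ∑[ u < n ] ∑[ v < n ] (⟦ adj G u v ⟧ * (⟦ P u ⟧ + ⟦ P v ⟧))
      ≤⟨ ∑-mono-≤ (λ u → ∑-mono-≤ λ v → ⟦a⟧*[⟦p⟧+⟦q⟧]≤⟦a⟧ (adj G u v) (P u) (P v) (independent u v)) ⟩
    ∑[ u < n ] ∑[ v < n ] ⟦ adj G u v ⟧
      ≡⟨ ∑-degree≡∑∑⟦adj⟧ G ⟨
    ∑[ v < n ] degree G v
      ≡⟨ handshake G ⟩
    2 * edgeCount G
      ∎)
    where
    open ≤-Reasoning
    W = ∑[ v < n ] (degree G v * ⟦ P v ⟧)

module _ {n : ℕ} (H : Graph n) where

  isLeaf : Fin n → Bool
  isLeaf v = degree H v ≡ᵇ 1

  leafCount≤edgeCount : (∀ u v → degree H u ≡ 1 → degree H v ≡ 1 → ¬ Adj H u v) →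
    ∑[ v < n ] ⟦ isLeaf v ⟧ ≤ edgeCount H
  leafCount≤edgeCount leaves-nonadjacent = begin
    ∑[ v < n ] ⟦ isLeaf v ⟧                  ≡⟨ sum-cong-≗ (n*⟦n≡ᵇ1⟧≡⟦n≡ᵇ1⟧ ∘ degree H) ⟨
    ∑[ v < n ] (degree H v * ⟦ isLeaf v ⟧)   ≤⟨ ∑-degree-independent≤edgeCount H isLeaf leaves-independent ⟩
    edgeCount H                              ∎
    where
    open ≤-Reasoning
    leaves-independent : ∀ u v → T (isLeaf u) → T (isLeaf v) → ¬ Adj H u v
    leaves-independent u v u-leaf v-leaf =
      leaves-nonadjacent u v (≡ᵇ⇒≡ _ 1 u-leaf) (≡ᵇ⇒≡ _ 1 v-leaf)

  2*n≤2*edgeCount+leafCount : (∀ v → 1 ≤ degree H v) →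
    2 * n ≤ 2 * edgeCount H + ∑[ v < n ] ⟦ isLeaf v ⟧
  2*n≤2*edgeCount+leafCount no-isolated = begin
    2 * n                                            ≡⟨ *-comm 2 n ⟩
    n * 2                                            ≡⟨ ∑-const n 2 ⟨
    ∑[ v < n ] 2                                     ≤⟨ ∑-mono-≤ (1≤n⇒2≤n+⟦n≡ᵇ1⟧ ∘ no-isolated) ⟩
    ∑[ v < n ] (degree H v + ⟦ isLeaf v ⟧)           ≡⟨ ∑-distrib-+ (degree H) (⟦_⟧ ∘ isLeaf) ⟩
    ∑[ v < n ] degree H v + ∑[ v < n ] ⟦ isLeaf v ⟧  ≡⟨ cong (_+ ∑[ v < n ] ⟦ isLeaf v ⟧) (handshake H) ⟩
    2 * edgeCount H + ∑[ v < n ] ⟦ isLeaf v ⟧        ∎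
    where open ≤-Reasoning

  2*n≤3*edgeCount : (∀ v → 1 ≤ degree H v) →
    (∀ u v → degree H u ≡ 1 → degree H v ≡ 1 → ¬ Adj H u v) →
    2 * n ≤ 3 * edgeCount H
  2*n≤3*edgeCount no-isolated leaves-nonadjacent = begin
    2 * n                                       ≤⟨ 2*n≤2*edgeCount+leafCount no-isolated ⟩
    2 * edgeCount H + ∑[ v < n ] ⟦ isLeaf v ⟧   ≤⟨ +-monoʳ-≤ (2 * edgeCount H) (leafCount≤edgeCount leaves-nonadjacent) ⟩
    2 * edgeCount H + edgeCount H               ≡⟨ +-comm (2 * edgeCount H) (edgeCount H) ⟩
    3 * edgeCount H                             ∎
    where open ≤-Reasoning

does[i≟j]≡does[j≟i] : ∀ {n} (i j : Fin n) → does (i ≟ j) ≡ does (j ≟ i)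
does[i≟j]≡does[j≟i] i j with i ≟ j
... | yes refl = sym (dec-true (i ≟ i) refl)
... | no i≢j   = sym (dec-false (j ≟ i) (i≢j ∘ sym))

complement : ∀ {n} → Graph n → Graph n
complement G = record
  { adj    = λ i j → not (adj G i j) ∧ not (does (i ≟ j))
  ; sym    = λ i j → cong₂ (λ a b → not a ∧ not b) (Graph.sym G i j) (does[i≟j]≡does[j≟i] i j)
  ; irrefl = λ i → trans (cong (λ b → not (adj G i i) ∧ not b) (dec-true (i ≟ i) refl)) (∧-zeroʳ _)
  }

Adj⇒≢ : ∀ {n} (G : Graph n) {u v} → Adj G u v → u ≢ v
Adj⇒≢ G {u} u~u refl = subst T (irrefl G u) u~u

Adj-complement⇒¬Adj : ∀ {n} (G : Graph n) {u v} → Adj (complement G) u v → ¬ Adj G u v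
Adj-complement⇒¬Adj G {u} {v} ū~v̄ with adj G u v
... | true  = ⊥-elim ū~v̄
... | false = λ ()

module _ {n : ℕ} (G : Graph n) where

  ⟦adj⟧+⟦adj-complement⟧+⟦≟⟧≡1 : ∀ i j → ⟦ adj G i j ⟧ + ⟦ adj (complement G) i j ⟧ + ⟦ does (i ≟ j) ⟧ ≡ 1
  ⟦adj⟧+⟦adj-complement⟧+⟦≟⟧≡1 i j with i ≟ j
  ... | yes refl rewrite irrefl G i = refl
  ... | no _ with adj G i j
  ...   | true  = refl
  ...   | false = refl

  degree+degree-complement : ∀ v → suc (degree G v + degree (complement G) v) ≡ n
  degree+degree-complement v = begin
    suc (degree G v + degree Ḡ v)
      ≡⟨ +-comm 1 _ ⟩
    degree G v + degree Ḡ v + 1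
      ≡⟨ cong₂ _+_ (cong₂ _+_ (degree≡∑ G v) (degree≡∑ Ḡ v)) (sym (∑⟦i≟j⟧≡1 v)) ⟩
    ∑[ j < n ] ⟦ adj G v j ⟧ + ∑[ j < n ] ⟦ adj Ḡ v j ⟧ + ∑[ j < n ] ⟦ does (v ≟ j) ⟧
      ≡⟨ cong (_+ _) (∑-distrib-+ (⟦_⟧ ∘ adj G v) (⟦_⟧ ∘ adj Ḡ v)) ⟨
    ∑[ j < n ] (⟦ adj G v j ⟧ + ⟦ adj Ḡ v j ⟧) + ∑[ j < n ] ⟦ does (v ≟ j) ⟧
      ≡⟨ ∑-distrib-+ (λ j → ⟦ adj G v j ⟧ + ⟦ adj Ḡ v j ⟧) (λ j → ⟦ does (v ≟ j) ⟧) ⟨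
    ∑[ j < n ] (⟦ adj G v j ⟧ + ⟦ adj Ḡ v j ⟧ + ⟦ does (v ≟ j) ⟧)
      ≡⟨ sum-cong-≗ (⟦adj⟧+⟦adj-complement⟧+⟦≟⟧≡1 v) ⟩
    ∑[ j < n ] 1
      ≡⟨ ∑-const n 1 ⟩
    n * 1
      ≡⟨ *-identityʳ n ⟩
    n ∎
    where
    open ≡-Reasoning
    Ḡ = complement G

module _ {n : ℕ} (G : Graph (suc n)) (v : Fin (suc n)) where

  degree<n⇒1≤degree-complement : degree G v < n → 1 ≤ degree (complement G) v
  degree<n⇒1≤degree-complement d<n = +-cancelˡ-< (degree G v) 0 _
    (subst₂ _<_ (sym (+-identityʳ _)) (sym (suc-injective (degree+degree-complement G v))) d<n)

  degree-complement≡1⇒degree≡n∸1 : degree (complement G) v ≡ 1 → degree G v ≡ n ∸ 1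
  degree-complement≡1⇒degree≡n∸1 d̄≡1 = begin
    degree G v                                ≡⟨ m+n∸n≡m (degree G v) 1 ⟨
    degree G v + 1 ∸ 1                        ≡⟨ cong (λ d → degree G v + d ∸ 1) d̄≡1 ⟨
    degree G v + degree (complement G) v ∸ 1  ≡⟨ cong (_∸ 1) (suc-injective (degree+degree-complement G v)) ⟩
    n ∸ 1                                     ∎
    where open ≡-Reasoning

2*[1+n]C2≡[1+n]*n : ∀ n → 2 * (suc n C 2) ≡ suc n * n
2*[1+n]C2≡[1+n]*n zero    = refl
2*[1+n]C2≡[1+n]*n (suc n) = begin
  2 * (suc (suc n) C 2)          ≡⟨ cong (2 *_) (nCk+nC[k+1]≡[n+1]C[k+1] (suc n) 1) ⟨
  2 * (suc n C 1 + suc n C 2)    ≡⟨ cong (λ c → 2 * (c + suc n C 2)) (nC1≡n (suc n)) ⟩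
  2 * (suc n + suc n C 2)        ≡⟨ *-distribˡ-+ 2 (suc n) (suc n C 2) ⟩
  2 * suc n + 2 * (suc n C 2)    ≡⟨ cong (2 * suc n +_) (2*[1+n]C2≡[1+n]*n n) ⟩
  2 * suc n + suc n * n          ≡⟨ solve (n ∷ []) ⟩
  suc (suc n) * suc n            ∎
  where open ≡-Reasoning

edgeCount+edgeCount-complement : ∀ {n} (G : Graph n) → edgeCount G + edgeCount (complement G) ≡ n C 2
edgeCount+edgeCount-complement {zero}  G = refl
edgeCount+edgeCount-complement {suc n} G = *-cancelˡ-≡ _ _ 2 (begin
  2 * (edgeCount G + edgeCount Ḡ)                        ≡⟨ *-distribˡ-+ 2 (edgeCount G) (edgeCount Ḡ) ⟩
  2 * edgeCount G + 2 * edgeCount Ḡ                      ≡⟨ cong₂ _+_ (handshake G) (handshake Ḡ) ⟨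
  ∑[ v < suc n ] degree G v + ∑[ v < suc n ] degree Ḡ v  ≡⟨ ∑-distrib-+ (degree G) (degree Ḡ) ⟨
  ∑[ v < suc n ] (degree G v + degree Ḡ v)               ≡⟨ sum-cong-≗ (suc-injective ∘ degree+degree-complement G) ⟩
  ∑[ v < suc n ] n                                       ≡⟨ ∑-const (suc n) n ⟩
  suc n * n                                              ≡⟨ 2*[1+n]C2≡[1+n]*n n ⟨
  2 * (suc n C 2)                                        ∎)
  where
  open ≡-Reasoning
  Ḡ = complement G

[r+q*d]/d≡q : ∀ r q d .{{_ : NonZero d}} → r < d → (r + q * d) / d ≡ q
[r+q*d]/d≡q r q d r<d = trans (+-distrib-/-∣ʳ r (n∣m*n q)) (cong₂ _+_ (m<n⇒m/n≡0 r<d) (m*n/n≡m q d))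

⌈/3⌉-least : ∀ {a b} → a ≤ 3 * b → ⌈ a /3⌉ ≤ b
⌈/3⌉-least {a} {b} a≤3b = ≤-pred (m<n*o⇒m/o<n (begin-strict
  a + 2      <⟨ +-monoʳ-< a (n<1+n 2) ⟩
  a + 3      ≤⟨ +-monoˡ-≤ 3 a≤3b ⟩
  3 * b + 3  ≡⟨ solve (b ∷ []) ⟩
  suc b * 3  ∎))
  where open ≤-Reasoning

3*⌈/3⌉-excess : ∀ a → ∃[ t ] t ≤ 2 × a + t ≡ 3 * ⌈ a /3⌉
3*⌈/3⌉-excess a = 2 ∸ e , m∸n≤m 2 e , +-cancelʳ-≡ e _ _ (begin
  a + (2 ∸ e) + e    ≡⟨ +-assoc a (2 ∸ e) e ⟩
  a + (2 ∸ e + e)    ≡⟨ cong (a +_) (m∸n+n≡m e≤2) ⟩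
  a + 2              ≡⟨ m≡m%n+[m/n]*n (a + 2) 3 ⟩
  e + ⌈ a /3⌉ * 3    ≡⟨ +-comm e _ ⟩
  ⌈ a /3⌉ * 3 + e    ≡⟨ cong (_+ e) (*-comm ⌈ a /3⌉ 3) ⟩
  3 * ⌈ a /3⌉ + e    ∎)
  where
  open ≡-Reasoning
  e = (a + 2) % 3
  e≤2 : e ≤ 2
  e≤2 = ≤-pred (m%n<n (a + 2) 3)

⌈2[1+r]/3⌉≤[1+r]C2 : ∀ r → 2 ≤ r → ⌈ 2 * suc r /3⌉ ≤ suc r C 2
⌈2[1+r]/3⌉≤[1+r]C2 r 2≤r = ⌈/3⌉-least {2 * suc r} {suc r C 2} (*-cancelˡ-≤ 2 (begin
  2 * (2 * suc r)         ≡⟨ solve (r ∷ []) ⟩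
  suc r * 4               ≤⟨ *-monoʳ-≤ (suc r) (≤-trans (n≤1+n 4) (n≤1+n 5)) ⟩
  suc r * 6               ≤⟨ *-monoʳ-≤ (suc r) (*-monoʳ-≤ 3 2≤r) ⟩
  suc r * (3 * r)         ≡⟨ solve (r ∷ []) ⟩
  3 * (suc r * r)         ≡⟨ cong (3 *_) (2*[1+n]C2≡[1+n]*n r) ⟨
  3 * (2 * (suc r C 2))   ≡⟨ *-assoc 3 2 (suc r C 2) ⟨
  6 * (suc r C 2)         ≡⟨ *-assoc 2 3 (suc r C 2) ⟩
  2 * (3 * (suc r C 2))   ∎))
  where open ≤-Reasoning

[1+r]C2∸⌈2[1+r]/3⌉≡[1+r][3r∸4]/6 : ∀ r → 3 ≤ r → suc r C 2 ∸ ⌈ 2 * suc r /3⌉ ≡ suc r * (3 * r ∸ 4) / 6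
[1+r]C2∸⌈2[1+r]/3⌉≡[1+r][3r∸4]/6 r@(suc (suc (suc s))) (s≤s (s≤s (s≤s z≤n)))
  with 3*⌈/3⌉-excess (2 * suc r)
... | t , t≤2 , 2[1+r]+t≡3c = sym (begin
  suc r * (3 * r ∸ 4) / 6    ≡⟨ cong (λ m → suc r * m / 6) 3r∸4≡5+3s ⟩
  suc r * (5 + 3 * s) / 6    ≡⟨ cong (_/ 6) (2t+x*6≡[4+s][5+3s] {q} {⌈ 2 * suc r /3⌉} 2[1+r]+t≡3c 2[q+c]≡[1+r]r) ⟨
  (2 * t + q * 6) / 6        ≡⟨ [r+q*d]/d≡q (2 * t) q 6 (s≤s (≤-trans (*-monoʳ-≤ 2 t≤2) (n≤1+n 4))) ⟩
  q                          ∎)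
  where
  open ≡-Reasoning
  q = suc r C 2 ∸ ⌈ 2 * suc r /3⌉

  2[q+c]≡[1+r]r : 2 * (q + ⌈ 2 * suc r /3⌉) ≡ suc r * r
  2[q+c]≡[1+r]r = trans (cong (2 *_) (m∸n+n≡m (⌈2[1+r]/3⌉≤[1+r]C2 r (s≤s (s≤s z≤n))))) (2*[1+n]C2≡[1+n]*n r)

  3r∸4≡5+3s : 3 * r ∸ 4 ≡ 5 + 3 * s
  3r∸4≡5+3s = begin
    3 * r ∸ 4             ≡⟨ cong (_∸ 4) 3r≡4+[5+3s] ⟩
    4 + (5 + 3 * s) ∸ 4   ≡⟨ m+n∸m≡n 4 (5 + 3 * s) ⟩
    5 + 3 * s             ∎
    where
    3r≡4+[5+3s] : 3 * r ≡ 4 + (5 + 3 * s)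
    3r≡4+[5+3s] = solve (s ∷ [])

  2t+x*6≡[4+s][5+3s] : ∀ {x c} → 2 * (4 + s) + t ≡ 3 * c → 2 * (x + c) ≡ (4 + s) * (3 + s) →
    2 * t + x * 6 ≡ (4 + s) * (5 + 3 * s)
  2t+x*6≡[4+s][5+3s] {x} {c} 2N+t≡3c 2[x+c]≡Nr = +-cancelʳ-≡ (4 * (4 + s)) _ _ (begin
    2 * t + x * 6 + 4 * (4 + s)          ≡⟨ solve (t ∷ x ∷ s ∷ []) ⟩
    6 * x + 2 * (2 * (4 + s) + t)        ≡⟨ cong (λ m → 6 * x + 2 * m) 2N+t≡3c ⟩
    6 * x + 2 * (3 * c)                  ≡⟨ solve (x ∷ c ∷ []) ⟩
    3 * (2 * (x + c))                    ≡⟨ cong (3 *_) 2[x+c]≡Nr ⟩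
    3 * ((4 + s) * (3 + s))              ≡⟨ solve (s ∷ []) ⟩
    (4 + s) * (5 + 3 * s) + 4 * (4 + s)  ∎)

corollary8 : (r : ℕ) → 3 ≤ r → (G : Graph (suc r)) →
    (∀ v → degree G v ≤ r ∸ 1) →
    (∀ u v → ¬ (u ≡ v) → degree G u ≡ r ∸ 1 → degree G v ≡ r ∸ 1 → Adj G u v) →
    (edgeCount G ≤ (suc r C 2) ∸ ⌈ 2 * suc r /3⌉)
    × ((suc r C 2) ∸ ⌈ 2 * suc r /3⌉ ≡ (suc r * (3 * r ∸ 4)) / 6)
-- Matching r against suc _ lets r ∸ 1 compute, so that Δ≤r∸1 v is a bound of the form degree < r.
corollary8 r@(suc _) 3≤r G Δ≤r∸1 full-vertices-adjacent =
  edgeCount-bound , [1+r]C2∸⌈2[1+r]/3⌉≡[1+r][3r∸4]/6 r 3≤r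
  where
  Ḡ = complement G

  no-isolated : ∀ v → 1 ≤ degree Ḡ v
  no-isolated v = degree<n⇒1≤degree-complement G v (s≤s (Δ≤r∸1 v))

  leaves-nonadjacent : ∀ u v → degree Ḡ u ≡ 1 → degree Ḡ v ≡ 1 → ¬ Adj Ḡ u v
  leaves-nonadjacent u v ū-leaf v̄-leaf ū~v̄ = Adj-complement⇒¬Adj G ū~v̄
    (full-vertices-adjacent u v (Adj⇒≢ Ḡ ū~v̄)
      (degree-complement≡1⇒degree≡n∸1 G u ū-leaf) (degree-complement≡1⇒degree≡n∸1 G v v̄-leaf))

  edgeCount-bound : edgeCount G ≤ suc r C 2 ∸ ⌈ 2 * suc r /3⌉
  edgeCount-bound = begin
    edgeCount G                              ≡⟨ m+n∸n≡m (edgeCount G) (edgeCount Ḡ) ⟨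
    edgeCount G + edgeCount Ḡ ∸ edgeCount Ḡ  ≡⟨ cong (_∸ edgeCount Ḡ) (edgeCount+edgeCount-complement G) ⟩
    suc r C 2 ∸ edgeCount Ḡ
      ≤⟨ ∸-monoʳ-≤ (suc r C 2) (⌈/3⌉-least {b = edgeCount Ḡ} (2*n≤3*edgeCount Ḡ no-isolated leaves-nonadjacent)) ⟩
    suc r C 2 ∸ ⌈ 2 * suc r /3⌉              ∎
    where open ≤-Reasoning
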